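{- Let $M$ be a monoid, written additively with unit $0$ but not necessarily commutative. Let $\mathcal R$ be the relation on $M$ with $a\,\mathcal R\,b$ iff there exist finite sequences $v,w$ of elements of $M$ such that $v$ is obtained from $w$ by deleting some entries (keeping the order of the rest), the sum of $v$ is $a$, and the sum of $w$ is $b$. Let $\preceq_{\min}$ be the transitive closure of $\mathcal R$. Then for $a,b\in M$, $a\preceq_{\min}b$ holds if and only if there is a monotone table whose first row has weight $a$ and whose last row has weight $b$.
   Context: A vector is a finite sequence of elements of $M$. Its weight is the sum of its entries in the given order, with the empty sum equal to $0$. Two vectors are isobaric if they have the same weight. An augmentation of a vector $(a_1,\dots,a_n)$ is a vector $(a_1,\dots,a_k,c,a_{k+1},\dots,a_n)$ for some $c\in M$ and some $k\in\{0,\dots,n\}$. A table is a finite sequence of vectors, called its rows. A table is monotone if each row is isobaric with some augmentation of the previous row. -}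

module Defs where

open import Level using (Level; _⊔_)
open import Algebra.Bundles using (Monoid)
open import Data.Nat using (ℕ)
open import Data.List using (List; []; _∷_; _++_; foldr; take; drop; length)
open import Data.List.NonEmpty using (List⁺; toList; head; last)
open import Data.List.Relation.Binary.Sublist.Propositional using (_⊆_)
open import Data.List.Relation.Unary.Linked using (Linked)
open import Relation.Binary.Construct.Closure.Transitive using (TransClosure)
open import Data.Product using (Σ; ∃; ∃-syntax; _×_)
open import Data.Nat using (_≤_)
open import Relation.Binary.PropositionalEquality using (_≡_)

module _ {c ℓ : Level} (M : Monoid c ℓ) where
  open Monoid M renaming (Carrier to A; _∙_ to _+_; ε to 0#)

  weight : List A → A
  weight = foldr _+_ 0#

  Isobaric : List A → List A → Set ℓ
  Isobaric v w = weight v ≈ weight w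

  IsAugmentation : List A → List A → Set c
  IsAugmentation u v =
    ∃[ k ] ∃[ x ] (k ≤ length v) × (u ≡ take k v ++ (x ∷ drop k v))

  Step : List A → List A → Set (c ⊔ ℓ)
  Step r r' = ∃[ u ] IsAugmentation u r × Isobaric r' u

  -- a table is a finite sequence of rows; "first/last row" requires it
  -- to be nonempty, so tables with first and last rows are List⁺
  Monotone : List⁺ (List A) → Set (c ⊔ ℓ)
  Monotone t = Linked Step (toList t)

  R : A → A → Set (c ⊔ ℓ)
  R a b = ∃[ v ] ∃[ w ] (v ⊆ w) × (weight v ≈ a) × (weight w ≈ b)

  _≼min_ : A → A → Set (c ⊔ ℓ)
  _≼min_ = TransClosure R

-- A single step of a monotone table is an instance of R: inserting an entry
-- turns the previous row into a supersequence. Conversely, a deletion v ⊆ w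
-- can be undone by a chain of single insertions, each a table step, and
-- consecutive instances of R are glued by inserting a 0 in front of a row,
-- which changes no weight. So a ≼min b iff some chain of table steps leads
-- from a row of weight a to a row of weight b, and such chains are tables.
module Submission where

open import Defs
open import Algebra.Bundles using (Monoid)
open import Data.List using (List; []; _∷_; _++_; take; drop; initLast; _∷ʳ′_)
open import Data.List.NonEmpty using (_∷_; toList; head; last)
open import Data.List.Relation.Binary.Sublist.Heterogeneous.Core using ([]; _∷ʳ_; _∷_)
open import Data.List.Relation.Binary.Sublist.Propositional using (_⊆_; ⊆-refl)
open import Data.List.Relation.Unary.Linked using (Linked; [-]; _∷_)
open import Data.Nat using (zero; suc; z≤n; s≤s)
open import Data.Product using (∃-syntax; _×_; _,_)
open import Function.Bundles using (_⇔_; mk⇔)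
open import Relation.Binary.Core using (Rel)
open import Relation.Binary.Construct.Closure.ReflexiveTransitive using (Star; ε; _◅_; _◅◅_; gmap)
open import Relation.Binary.Construct.Closure.Transitive using ([_]; _∷_)
open import Relation.Binary.PropositionalEquality as ≡ using (_≡_; refl)

last-∷ : ∀ {a} {A : Set a} (x y : A) ys → last (x ∷ y ∷ ys) ≡ last (y ∷ ys)
last-∷ x y ys with initLast ys
... | []       = refl
... | _ ∷ʳ′ _ = refl

⊆-insert : ∀ {a} {A : Set a} k (xs : List A) x → xs ⊆ take k xs ++ x ∷ drop k xs
⊆-insert zero    xs       x = x ∷ʳ ⊆-refl
⊆-insert (suc k) []       x = x ∷ʳ []
⊆-insert (suc k) (y ∷ xs) x = refl ∷ ⊆-insert k xs x

module _ {a r} {A : Set a} {_∼_ : Rel A r} where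

  Linked⇒Star : ∀ x xs → Linked _∼_ (x ∷ xs) → Star _∼_ x (last (x ∷ xs))
  Linked⇒Star x []       [-]     = ε
  Linked⇒Star x (y ∷ ys) (p ∷ l) =
    p ◅ ≡.subst (Star _∼_ y) (≡.sym (last-∷ x y ys)) (Linked⇒Star y ys l)

  Star⇒Linked : ∀ {x y} → Star _∼_ x y →
                ∃[ t ] Linked _∼_ (toList t) × head t ≡ x × last t ≡ y
  Star⇒Linked {x} ε = (x ∷ []) , [-] , refl , refl
  Star⇒Linked {x} (p ◅ st) with Star⇒Linked st
  ... | (y ∷ ys) , l , refl , e = (x ∷ y ∷ ys) , p ∷ l , refl , ≡.trans (last-∷ x y ys) e

module _ {c ℓ} (M : Monoid c ℓ) where
  open Monoid M renaming (Carrier to A; _∙_ to _+_; ε to 0#; refl to ≈-refl; sym to ≈-sym; trans to ≈-trans)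
  open import Relation.Binary.Reasoning.Setoid setoid

  Steps : Rel (List A) _
  Steps = Star (Step M)

  _⇝_ : Rel A _
  a ⇝ b = ∃[ v ] ∃[ w ] Steps v w × weight M v ≈ a × weight M w ≈ b

  augmentation⇒⊇ : ∀ {u v} → IsAugmentation M u v → v ⊆ u
  augmentation⇒⊇ {v = v} (k , x , _ , refl) = ⊆-insert k v x

  Step⇒⊆ : ∀ {r r'} → Step M r r' → ∃[ u ] r ⊆ u × weight M u ≈ weight M r'
  Step⇒⊆ (u , aug , iso) = u , augmentation⇒⊇ aug , ≈-sym iso

  Steps⇒≼min : ∀ {v w a b} → Steps v w → weight M v ≈ a → weight M w ≈ b → _≼min_ M a b
  Steps⇒≼min {v} ε         va wb = [ v , v , ⊆-refl , va , wb ]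
  Steps⇒≼min {v} (_◅_ {j = r} s st) va wb with Step⇒⊆ {v} {r} s
  ... | u , v⊆u , uw = (v , u , v⊆u , va , uw) ∷ Steps⇒≼min st ≈-refl wb

  Step-insertˡ : ∀ x r → Step M r (x ∷ r)
  Step-insertˡ x r = (x ∷ r) , (0 , x , z≤n , refl) , ≈-refl

  Step-∷ : ∀ y {r r'} → Step M r r' → Step M (y ∷ r) (y ∷ r')
  Step-∷ y (u , (k , x , k≤ , refl) , iso) = (y ∷ u) , (suc k , x , s≤s k≤ , refl) , ∙-congˡ iso

  ⊆⇒Steps : ∀ {v w} → v ⊆ w → Steps v w
  ⊆⇒Steps []                  = ε
  ⊆⇒Steps (y ∷ʳ p)            = ⊆⇒Steps p ◅◅ Step-insertˡ y _ ◅ ε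
  ⊆⇒Steps (_∷_ {x = y} refl p) = gmap (y ∷_) (λ {r} {r'} → Step-∷ y {r} {r'}) (⊆⇒Steps p)

  Step-isobaric : ∀ {r r'} → weight M r' ≈ weight M r → Step M r r'
  Step-isobaric {r} {r'} iso = (0# ∷ r) , (0 , 0# , z≤n , refl) , (begin
    weight M r'      ≈⟨ iso ⟩
    weight M r       ≈⟨ identityˡ _ ⟨
    0# + weight M r  ∎)

  R⇒⇝ : ∀ {a b} → R M a b → a ⇝ b
  R⇒⇝ (v , w , v⊆w , va , wb) = v , w , ⊆⇒Steps v⊆w , va , wb

  ⇝-trans : ∀ {a b c} → a ⇝ b → b ⇝ c → a ⇝ c
  ⇝-trans (v , w , st , va , wb) (v' , w' , st' , v'b , w'c) =
    v , w' , st ◅◅ Step-isobaric {w} {v'} (≈-trans v'b (≈-sym wb)) ◅ st' , va , w'c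

  ≼min⇒⇝ : ∀ {a b} → _≼min_ M a b → a ⇝ b
  ≼min⇒⇝ [ aRb ]      = R⇒⇝ aRb
  ≼min⇒⇝ (aRb ∷ b≼c) = ⇝-trans (R⇒⇝ aRb) (≼min⇒⇝ b≼c)

proposition2 : ∀ {c ℓ} (M : Monoid c ℓ) (a b : Monoid.Carrier M) →
    _≼min_ M a b ⇔
      (∃[ t ] Monotone M t × Monoid._≈_ M (weight M (head t)) a
                          × Monoid._≈_ M (weight M (last t)) b)
proposition2 M a b = mk⇔ to from
  where
  to : _≼min_ M a b → ∃[ t ] Monotone M t × _ × _
  to a≼b with ≼min⇒⇝ M a≼b
  ... | v , w , st , va , wb with Star⇒Linked st
  ...   | t , mono , refl , refl = t , mono , va , wb
  from : (∃[ t ] Monotone M t × _ × _) → _≼min_ M a b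
  from ((r ∷ rs) , mono , ra , tb) = Steps⇒≼min M (Linked⇒Star r rs mono) ra tb
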